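{- Let $k \geq 2$ be an integer, let $f_k(T) = T^k - T^{k-1} - \cdots - T - 1 \in \mathbb{Z}[T]$, and let $\alpha_1$ be the unique real root of $f_k$ with $|\alpha_1|>1$ (the dominant root). Then \[ N\big((k+1)\alpha_1 - 2k\big) = (-1)^k \Big( (2k)^{k-1}(k-1) - \sum_{j=0}^{k-2} (k+1)^{k-j}(2k)^j \Big), \] where $N$ denotes the norm map of the field extension $\mathbb{Q}(\alpha_1)/\mathbb{Q}$.
   Context: It is known that $f_k$ is irreducible over $\mathbb{Q}$ with simple roots $\alpha_1,\dots,\alpha_k$, which can be ordered so that $3^{ -k}<|\alpha_k|\leq\cdots\leq|\alpha_2|<1<|\alpha_1|$, with $\alpha_1\in\mathbb{R}$ and $2(1-2^{ -k})<\alpha_1<2$; in particular $[\mathbb{Q}(\alpha_1):\mathbb{Q}]=k$. -}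

module Defs where

open import Data.Nat as ℕ using (ℕ; zero; suc)
open import Data.Integer using (ℤ; +_; -_; _+_; _*_; _-_; _^_)
open import Data.Fin using (Fin; zero; suc; toℕ; punchIn)
open import Data.Bool using (if_then_else_)
open import Relation.Nullary.Decidable using (⌊_⌋)

sumℤ : (n : ℕ) → (ℕ → ℤ) → ℤ
sumℤ zero    f = + 0
sumℤ (suc n) f = sumℤ n f + f n

Mat : ℕ → Set
Mat n = Fin n → Fin n → ℤ

det : (n : ℕ) → Mat n → ℤ
det zero    M = + 1
det (suc n) M = go (suc n) (λ j → M zero j)
  where
  minor : Fin (suc n) → Mat n
  minor j r c = M (suc r) (punchIn j c)
  go : (m : ℕ) → (Fin (suc n) → ℤ) → ℤ
  go m row = sumF (suc n) (λ j → ((- + 1) ^ toℕ j) * (row j * det n (minor j)))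
    where
    sumF : (l : ℕ) → (Fin l → ℤ) → ℤ
    sumF zero    g = + 0
    sumF (suc l) g = g zero + sumF l (λ i → g (suc i))

-- Matrix of multiplication by α (root of f_k = T^k - T^{k-1} - ... - 1)
-- on ℚ(α) ≅ ℚ[T]/(f_k), in the basis 1, α, ..., α^{k-1}.
-- Entry (r , c) = coefficient of α^r in α · α^c:
--   α · α^c = α^{c+1}                       for c < k-1,
--   α · α^{k-1} = α^k = 1 + α + ... + α^{k-1}.
multAlpha : (k : ℕ) → Mat k
multAlpha k r c =
  if ⌊ suc (toℕ c) ℕ.≟ k ⌋ then + 1
  else (if ⌊ toℕ r ℕ.≟ suc (toℕ c) ⌋ then + 1 else + 0)

idMat : (k : ℕ) → Mat k
idMat k r c = if ⌊ toℕ r ℕ.≟ toℕ c ⌋ then + 1 else + 0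

-- Norm N_{ℚ(α)/ℚ}(a + b α) = det of the ℚ-linear map "multiply by a + b α"
-- (matrix with integer entries, so the norm is an integer).
normLin : (k : ℕ) → ℤ → ℤ → ℤ
normLin k a b = det k (λ r c → a * idMat k r c + b * multAlpha k r c)

-- The matrix of multiplication by a + bα in the basis 1, α, …, α^(k-1) has first row
-- (a, 0, …, 0, b). Expanding along it, the top-left minor is the same matrix one size smaller
-- and the top-right minor is upper triangular with diagonal b, so D_{s+1} = a D_s + (-1)^s b^(s+1).
-- For a = -c this solves to D_s = (-1)^s (c^s - Σ_{j<s} b^(s-j) c^j); with c = 2k, b = k + 1 the
-- term j = k - 1 of the sum combines with c^k into (2k)^(k-1) (k - 1), since c - b = k - 1.

module Submission where

open import Defs
open import Data.Nat using (ℕ; zero; suc; _≤_; _<_; _∸_; z<s; s<s)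
import Data.Nat as ℕ
open import Data.Integer using (ℤ; +_; -_; _+_; _*_; _-_; _^_; 0ℤ; 1ℤ; -1ℤ)
import Data.Integer.Properties as ℤ
open import Data.Fin using (Fin; zero; suc; toℕ; punchIn; inject₁; fromℕ)
open import Data.Fin.Properties using (toℕ-fromℕ; toℕ-inject₁; toℕ<n)
import Data.Nat.Properties as ℕ
open import Data.Vec.Functional using (Vector; tail)
open import Algebra.Properties.CommutativeMonoid.Sum ℤ.+-0-commutativeMonoid
  using (sum; sum-cong-≗; sum-replicate-zero; sum-init-last)
open import Relation.Binary.PropositionalEquality
open ≡-Reasoning
open import Data.Bool using (true; false)
open import Relation.Nullary.Decidable using (⌊_⌋; isYes≗does; dec-true; dec-false)
open import Data.List using (_∷_; [])
open import Function using (_∘_)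
open import Data.Integer.Tactic.RingSolver using (solve; solve-∀)
open import Data.Nat.Tactic.RingSolver using () renaming (solve-∀ to ℕ-solve-∀)

minor : ∀ {n} → Fin (suc n) → Mat (suc n) → Mat n
minor j M r c = M (suc r) (punchIn j c)

cofactorTerm : ∀ {n} → Mat (suc n) → Fin (suc n) → ℤ
cofactorTerm {n} M j = -1ℤ ^ toℕ j * (M zero j * det n (minor j M))

sum-unique : (F : ∀ l → Vector ℤ l → ℤ) → (∀ g → F 0 g ≡ 0ℤ) →
             (∀ l g → F (suc l) g ≡ g zero + F l (tail g)) →
             ∀ l (g : Vector ℤ l) → F l g ≡ sum g
sum-unique F F-zero F-suc zero    g = F-zero g
sum-unique F F-zero F-suc (suc l) g =
  trans (F-suc l g) (cong (_+_ (g zero)) (sum-unique F F-zero F-suc l (tail g)))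

-- `det` sums its Laplace expansion with a helper local to its `where` block, which cannot be
-- named; `detRowSum` is that helper, solved by unification in `laplace₂`. The `with`s turn the
-- remaining summands and the matrix size into variables distinct from the length, as unification needs.
mutual
  detRowSum : (n : ℕ) → Mat (suc n) → (l : ℕ) → Vector ℤ l → ℤ
  detRowSum = _

  laplace₂ : ∀ n (M : Mat (suc (suc n))) → det (suc (suc n)) M ≡ sum (cofactorTerm M)
  laplace₂ n M with cofactorTerm M zero | cofactorTerm M (suc zero) | tail (tail (cofactorTerm M))
  ... | t₀ | t₁ | t with suc n
  ... | m = cong (λ s → t₀ + (t₁ + s)) (sum-unique (detRowSum m M) (λ _ → refl) (λ _ _ → refl) n t)

laplace : ∀ n (M : Mat (suc n)) → det (suc n) M ≡ sum (cofactorTerm M)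
laplace zero    M = refl
laplace (suc n) M = laplace₂ n M

det-cong : ∀ n {M N : Mat n} → (∀ r c → M r c ≡ N r c) → det n M ≡ det n N
det-cong zero    M≡N = refl
det-cong (suc n) {M} {N} M≡N = begin
  det (suc n) M           ≡⟨ laplace n M ⟩
  sum (cofactorTerm M)    ≡⟨ sum-cong-≗ cofactor≡ ⟩
  sum (cofactorTerm N)    ≡⟨ laplace n N ⟨
  det (suc n) N           ∎
  where
  cofactor≡ : ∀ j → cofactorTerm M j ≡ cofactorTerm N j
  cofactor≡ j = cong₂ (λ x y → -1ℤ ^ toℕ j * (x * y))
                      (M≡N zero j) (det-cong n (λ r c → M≡N (suc r) (punchIn j c)))

sum-zero : ∀ {n} {g : Vector ℤ n} → (∀ j → g j ≡ 0ℤ) → sum g ≡ 0ℤ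
sum-zero {n} g≡0 = trans (sum-cong-≗ g≡0) (sum-replicate-zero n)

cofactorTerm-entry≡0 : ∀ {n} (M : Mat (suc n)) j → M zero j ≡ 0ℤ → cofactorTerm M j ≡ 0ℤ
cofactorTerm-entry≡0 {n} M j M₀ⱼ≡0 = begin
  -1ℤ ^ toℕ j * (M zero j * det n (minor j M))  ≡⟨ cong (λ x → -1ℤ ^ toℕ j * (x * det n (minor j M))) M₀ⱼ≡0 ⟩
  -1ℤ ^ toℕ j * (0ℤ * det n (minor j M))        ≡⟨ cong (-1ℤ ^ toℕ j *_) (ℤ.*-zeroˡ (det n (minor j M))) ⟩
  -1ℤ ^ toℕ j * 0ℤ                              ≡⟨ ℤ.*-zeroʳ (-1ℤ ^ toℕ j) ⟩
  0ℤ                                            ∎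

cofactorTerm-minor≡0 : ∀ {n} (M : Mat (suc n)) j → det n (minor j M) ≡ 0ℤ → cofactorTerm M j ≡ 0ℤ
cofactorTerm-minor≡0 {n} M j minor≡0 = begin
  -1ℤ ^ toℕ j * (M zero j * det n (minor j M))  ≡⟨ cong (λ x → -1ℤ ^ toℕ j * (M zero j * x)) minor≡0 ⟩
  -1ℤ ^ toℕ j * (M zero j * 0ℤ)                 ≡⟨ cong (-1ℤ ^ toℕ j *_) (ℤ.*-zeroʳ (M zero j)) ⟩
  -1ℤ ^ toℕ j * 0ℤ                              ≡⟨ ℤ.*-zeroʳ (-1ℤ ^ toℕ j) ⟩
  0ℤ                                            ∎

det-zeroColumn : ∀ n (M : Mat (suc n)) → (∀ r → M r zero ≡ 0ℤ) → det (suc n) M ≡ 0ℤ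
cofactorTerm-zeroColumn : ∀ n (M : Mat (suc n)) → (∀ r → M r zero ≡ 0ℤ) → ∀ j → cofactorTerm M j ≡ 0ℤ

det-zeroColumn n M col≡0 = trans (laplace n M) (sum-zero (cofactorTerm-zeroColumn n M col≡0))

cofactorTerm-zeroColumn n       M col≡0 zero    = cofactorTerm-entry≡0 M zero (col≡0 zero)
cofactorTerm-zeroColumn (suc n) M col≡0 (suc j) =
  cofactorTerm-minor≡0 M (suc j) (det-zeroColumn n (minor (suc j) M) (λ r → col≡0 (suc r)))

det-firstColumn : ∀ n (M : Mat (suc n)) → (∀ r → M (suc r) zero ≡ 0ℤ) →
                  det (suc n) M ≡ M zero zero * det n (minor zero M)
det-firstColumn n M col≡0 = begin
  det (suc n) M                                      ≡⟨ laplace n M ⟩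
  cofactorTerm M zero + sum (tail (cofactorTerm M))  ≡⟨ cong (_+_ (cofactorTerm M zero)) (sum-zero (tail≡0 n M col≡0)) ⟩
  cofactorTerm M zero + 0ℤ                           ≡⟨ ℤ.+-identityʳ _ ⟩
  cofactorTerm M zero                                ≡⟨ ℤ.*-identityˡ _ ⟩
  M zero zero * det n (minor zero M)                 ∎
  where
  tail≡0 : ∀ n (M : Mat (suc n)) → (∀ r → M (suc r) zero ≡ 0ℤ) → ∀ i → cofactorTerm M (suc i) ≡ 0ℤ
  tail≡0 (suc n) M col≡0 i =
    cofactorTerm-minor≡0 M (suc i) (det-zeroColumn n (minor (suc i) M) col≡0)

det-upperTriangular : ∀ n (M : Mat n) d → (∀ r c → toℕ c < toℕ r → M r c ≡ 0ℤ) →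
                      (∀ i → M i i ≡ d) → det n M ≡ d ^ n
det-upperTriangular zero    M d below≡0 diag≡d = refl
det-upperTriangular (suc n) M d below≡0 diag≡d = begin
  det (suc n) M                       ≡⟨ det-firstColumn n M (λ r → below≡0 (suc r) zero z<s) ⟩
  M zero zero * det n (minor zero M)  ≡⟨ cong₂ _*_ (diag≡d zero) minor≡ ⟩
  d * d ^ n                           ∎
  where
  minor≡ : det n (minor zero M) ≡ d ^ n
  minor≡ = det-upperTriangular n (minor zero M) d
             (λ r c c<r → below≡0 (suc r) (suc c) (s<s c<r)) (λ i → diag≡d (suc i))

det-firstRowEnds : ∀ n (M : Mat (suc (suc n))) → (∀ (i : Fin n) → M zero (suc (inject₁ i)) ≡ 0ℤ) →
  det (suc (suc n)) M ≡ M zero zero * det (suc n) (minor zero M)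
                       + -1ℤ ^ suc n * (M zero (fromℕ (suc n)) * det (suc n) (minor (fromℕ (suc n)) M))
det-firstRowEnds n M middle≡0 = begin
  det (suc (suc n)) M                                     ≡⟨ laplace (suc n) M ⟩
  t zero + sum (tail t)                                   ≡⟨ cong (_+_ (t zero)) (sum-init-last (tail t)) ⟩
  t zero + (sum (λ i → t (suc (inject₁ i))) + t lastᶜ)    ≡⟨ cong (λ s → t zero + (s + t lastᶜ)) middleSum≡0 ⟩
  t zero + (0ℤ + t lastᶜ)                                 ≡⟨ cong₂ _+_ (ℤ.*-identityˡ firstTerm) (ℤ.+-identityˡ (t lastᶜ)) ⟩
  firstTerm + t lastᶜ                                     ≡⟨ cong (λ e → firstTerm + -1ℤ ^ suc e * lastTerm) (toℕ-fromℕ n) ⟩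
  firstTerm + -1ℤ ^ suc n * lastTerm                      ∎
  where
  t = cofactorTerm M
  lastᶜ = fromℕ (suc n)
  firstTerm = M zero zero * det (suc n) (minor zero M)
  lastTerm = M zero lastᶜ * det (suc n) (minor lastᶜ M)
  middleSum≡0 : sum (λ i → t (suc (inject₁ i))) ≡ 0ℤ
  middleSum≡0 = sum-zero (λ i → cofactorTerm-entry≡0 M (suc (inject₁ i)) (middle≡0 i))

≟-true : ∀ {m n} → m ≡ n → ⌊ m ℕ.≟ n ⌋ ≡ true
≟-true {m} {n} m≡n = trans (isYes≗does (m ℕ.≟ n)) (dec-true (m ℕ.≟ n) m≡n)

≟-false : ∀ {m n} → m ≢ n → ⌊ m ℕ.≟ n ⌋ ≡ false
≟-false {m} {n} m≢n = trans (isYes≗does (m ℕ.≟ n)) (dec-false (m ℕ.≟ n) m≢n)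

≟-suc : ∀ m n → ⌊ suc m ℕ.≟ suc n ⌋ ≡ ⌊ m ℕ.≟ n ⌋
≟-suc m n = trans (isYes≗does (suc m ℕ.≟ suc n)) (sym (isYes≗does (m ℕ.≟ n)))

punchIn-fromℕ : ∀ n (c : Fin n) → punchIn (fromℕ n) c ≡ inject₁ c
punchIn-fromℕ (suc n) zero    = refl
punchIn-fromℕ (suc n) (suc c) = cong suc (punchIn-fromℕ n c)

multLinear : (k : ℕ) → ℤ → ℤ → Mat k
multLinear k a b r c = a * idMat k r c + b * multAlpha k r c

multLinear-suc : ∀ k a b (r c : Fin k) → multLinear (suc k) a b (suc r) (suc c) ≡ multLinear k a b r c
multLinear-suc k a b r c
  rewrite ≟-suc (toℕ r) (toℕ c) | ≟-suc (suc (toℕ c)) k | ≟-suc (toℕ r) (suc (toℕ c)) = refl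

module _ (n : ℕ) (a b : ℤ) where

  private
    N = multLinear (suc (suc n)) a b

  multLinear-topLeft : N zero zero ≡ a
  multLinear-topLeft = trans (cong₂ _+_ (ℤ.*-identityʳ a) (ℤ.*-zeroʳ b)) (ℤ.+-identityʳ a)

  multLinear-topMiddle : ∀ (i : Fin n) → N zero (suc (inject₁ i)) ≡ 0ℤ
  multLinear-topMiddle i
    rewrite toℕ-inject₁ i | ≟-false (ℕ.<⇒≢ (s<s (s<s (toℕ<n i)))) =
    trans (cong₂ _+_ (ℤ.*-zeroʳ a) (ℤ.*-zeroʳ b)) (ℤ.+-identityʳ 0ℤ)

  multLinear-topRight : N zero (fromℕ (suc n)) ≡ b
  multLinear-topRight rewrite ≟-true (cong (λ m → suc (suc m)) (toℕ-fromℕ n)) =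
    trans (cong₂ _+_ (ℤ.*-zeroʳ a) (ℤ.*-identityʳ b)) (ℤ.+-identityˡ b)

  multLinear-lastMinor-below : ∀ (r c : Fin (suc n)) → toℕ c < toℕ r → minor (fromℕ (suc n)) N r c ≡ 0ℤ
  multLinear-lastMinor-below r c c<r
    rewrite punchIn-fromℕ (suc n) c | toℕ-inject₁ c
          | ≟-false (ℕ.<⇒≢ (ℕ.m<n⇒m<1+n c<r) ∘ sym)
          | ≟-false (ℕ.<⇒≢ (s<s (toℕ<n c)))
          | ≟-false (ℕ.<⇒≢ (s<s c<r) ∘ sym) =
    trans (cong₂ _+_ (ℤ.*-zeroʳ a) (ℤ.*-zeroʳ b)) (ℤ.+-identityʳ 0ℤ)

  multLinear-lastMinor-diagonal : ∀ (r : Fin (suc n)) → minor (fromℕ (suc n)) N r r ≡ b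
  multLinear-lastMinor-diagonal r
    rewrite punchIn-fromℕ (suc n) r | toℕ-inject₁ r
          | ≟-false (ℕ.1+n≢n {toℕ r})
          | ≟-false (ℕ.<⇒≢ (s<s (toℕ<n r)))
          | ≟-true (refl {x = suc (toℕ r)}) =
    trans (cong₂ _+_ (ℤ.*-zeroʳ a) (ℤ.*-identityʳ b)) (ℤ.+-identityˡ b)

  det-multLinear-lastMinor : det (suc n) (minor (fromℕ (suc n)) N) ≡ b ^ suc n
  det-multLinear-lastMinor = det-upperTriangular (suc n) (minor (fromℕ (suc n)) N) b
                               multLinear-lastMinor-below multLinear-lastMinor-diagonal

det-multLinear-suc : ∀ s a b →
  det (suc s) (multLinear (suc s) a b) ≡ a * det s (multLinear s a b) + -1ℤ ^ s * b ^ suc s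
det-multLinear-suc zero a b = begin
  1ℤ * ((a * 1ℤ + b * 1ℤ) * 1ℤ) + 0ℤ  ≡⟨ solve (a ∷ b ∷ []) ⟩
  a * 1ℤ + 1ℤ * (b * 1ℤ)              ∎
det-multLinear-suc (suc n) a b = begin
  det (suc (suc n)) N
    ≡⟨ det-firstRowEnds n N (multLinear-topMiddle n a b) ⟩
  N zero zero * det (suc n) (minor zero N) + -1ℤ ^ suc n * (N zero lastᶜ * det (suc n) (minor lastᶜ N))
    ≡⟨ cong₂ (λ x y → x * det (suc n) (minor zero N) + -1ℤ ^ suc n * (y * det (suc n) (minor lastᶜ N)))
             (multLinear-topLeft n a b) (multLinear-topRight n a b) ⟩
  a * det (suc n) (minor zero N) + -1ℤ ^ suc n * (b * det (suc n) (minor lastᶜ N))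
    ≡⟨ cong₂ (λ x y → a * x + -1ℤ ^ suc n * (b * y))
             (det-cong (suc n) (multLinear-suc (suc n) a b)) (det-multLinear-lastMinor n a b) ⟩
  a * det (suc n) (multLinear (suc n) a b) + -1ℤ ^ suc n * b ^ suc (suc n)
    ∎
  where
  N = multLinear (suc (suc n)) a b
  lastᶜ = fromℕ (suc n)

sumℤ-cong : ∀ n {f g : ℕ → ℤ} → (∀ j → j < n → f j ≡ g j) → sumℤ n f ≡ sumℤ n g
sumℤ-cong zero    f≡g = refl
sumℤ-cong (suc n) f≡g = cong₂ _+_ (sumℤ-cong n (λ j j<n → f≡g j (ℕ.m<n⇒m<1+n j<n))) (f≡g n (ℕ.n<1+n n))

sumℤ-*ˡ : ∀ n x (f : ℕ → ℤ) → sumℤ n (λ j → x * f j) ≡ x * sumℤ n f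
sumℤ-*ˡ zero    x f = sym (ℤ.*-zeroʳ x)
sumℤ-*ˡ (suc n) x f = trans (cong (_+ x * f n) (sumℤ-*ˡ n x f)) (sym (ℤ.*-distribˡ-+ x (sumℤ n f) (f n)))

homogeneousSum : ℤ → ℤ → ℕ → ℤ
homogeneousSum x y s = sumℤ s (λ j → x ^ (s ∸ j) * y ^ j)

homogeneousSum-suc-x : ∀ x y s → homogeneousSum x y (suc s) ≡ x * homogeneousSum x y s + x * y ^ s
homogeneousSum-suc-x x y s = cong₂ _+_ init≡ last≡
  where
  init≡ : sumℤ s (λ j → x ^ (suc s ∸ j) * y ^ j) ≡ x * homogeneousSum x y s
  init≡ = trans (sumℤ-cong s (λ j j<s → trans (cong (λ e → x ^ e * y ^ j) (ℕ.+-∸-assoc 1 (ℕ.<⇒≤ j<s)))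
                                              (ℤ.*-assoc x (x ^ (s ∸ j)) (y ^ j))))
                (sumℤ-*ˡ s x (λ j → x ^ (s ∸ j) * y ^ j))
  last≡ : x ^ (suc s ∸ s) * y ^ s ≡ x * y ^ s
  last≡ = trans (cong (λ e → x ^ e * y ^ s) (ℕ.m+n∸n≡m 1 s)) (cong (_* y ^ s) (ℤ.*-identityʳ x))

homogeneousSum-suc-y : ∀ x y s → homogeneousSum x y (suc s) ≡ x ^ suc s + y * homogeneousSum x y s
homogeneousSum-suc-y x y zero = begin
  0ℤ + x * 1ℤ * 1ℤ  ≡⟨ solve (x ∷ y ∷ []) ⟩
  x * 1ℤ + y * 0ℤ   ∎
homogeneousSum-suc-y x y (suc s) = begin
  homogeneousSum x y (suc (suc s))
    ≡⟨ homogeneousSum-suc-x x y (suc s) ⟩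
  x * homogeneousSum x y (suc s) + x * y ^ suc s
    ≡⟨ cong (λ h → x * h + x * y ^ suc s) (homogeneousSum-suc-y x y s) ⟩
  x * (x ^ suc s + y * H) + x * (y * y ^ s)
    ≡⟨ regroup x y (x ^ suc s) H (y ^ s) ⟩
  x * x ^ suc s + y * (x * H + x * y ^ s)
    ≡⟨ cong (λ h → x ^ suc (suc s) + y * h) (homogeneousSum-suc-x x y s) ⟨
  x ^ suc (suc s) + y * homogeneousSum x y (suc s)
    ∎
  where
  H = homogeneousSum x y s
  regroup : ∀ x y P H Q → x * (P + y * H) + x * (y * Q) ≡ x * P + y * (x * H + x * Q)
  regroup = solve-∀

det-multLinear-closedForm : ∀ s c b →
  det s (multLinear s (- c) b) ≡ -1ℤ ^ s * (c ^ s - homogeneousSum b c s)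
det-multLinear-closedForm zero    c b = refl
det-multLinear-closedForm (suc s) c b = begin
  det (suc s) (multLinear (suc s) (- c) b)
    ≡⟨ det-multLinear-suc s (- c) b ⟩
  - c * det s (multLinear s (- c) b) + -1ℤ ^ s * b ^ suc s
    ≡⟨ cong (λ d → - c * d + -1ℤ ^ s * b ^ suc s) (det-multLinear-closedForm s c b) ⟩
  - c * (-1ℤ ^ s * (c ^ s - H)) + -1ℤ ^ s * b ^ suc s
    ≡⟨ regroup c (-1ℤ ^ s) (c ^ s) H (b ^ suc s) ⟩
  -1ℤ ^ suc s * (c ^ suc s - (b ^ suc s + c * H))
    ≡⟨ cong (λ h → -1ℤ ^ suc s * (c ^ suc s - h)) (homogeneousSum-suc-y b c s) ⟨
  -1ℤ ^ suc s * (c ^ suc s - homogeneousSum b c (suc s))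
    ∎
  where
  H = homogeneousSum b c s
  regroup : ∀ c σ P H B → - c * (σ * (P - H)) + σ * B ≡ - 1ℤ * σ * (c * P - (B + c * H))
  regroup = solve-∀

lemma2p3 : (k : ℕ) → 2 ≤ k →
  normLin k (- (+ (2 Data.Nat.* k))) (+ (k Data.Nat.+ 1))
    ≡ ((- + 1) ^ k) * (((+ (2 Data.Nat.* k)) ^ (k Data.Nat.∸ 1)) * (+ (k Data.Nat.∸ 1))
        - sumℤ (k Data.Nat.∸ 1) (λ j → ((+ (k Data.Nat.+ 1)) ^ (k Data.Nat.∸ j)) * ((+ (2 Data.Nat.* k)) ^ j)))
lemma2p3 zero    ()
lemma2p3 (suc m) _  = begin
  det k (multLinear k (- c) b)                  ≡⟨ det-multLinear-closedForm k c b ⟩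
  σ * (c * P - (X + b ^ (k ∸ m) * P))           ≡⟨ cong (λ e → σ * (c * P - (X + b ^ e * P))) (ℕ.m+n∸n≡m 1 m) ⟩
  σ * (c * P - (X + b * 1ℤ * P))                ≡⟨ cong (λ x → σ * (x * P - (X + b * 1ℤ * P))) c≡b+m ⟩
  σ * ((b + + m) * P - (X + b * 1ℤ * P))        ≡⟨ cancel σ b (+ m) P X ⟩
  σ * (P * + m - X)                             ∎
  where
  k = suc m
  c = + (2 ℕ.* k)
  b = + (k ℕ.+ 1)
  σ = -1ℤ ^ k
  P = c ^ m
  X = sumℤ m (λ j → b ^ (k ∸ j) * c ^ j)
  c≡b+m : c ≡ b + + m
  c≡b+m = trans (cong +_ (ℕ-arith m)) (ℤ.pos-+ (k ℕ.+ 1) m)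
    where
    ℕ-arith : ∀ m → 2 ℕ.* suc m ≡ suc m ℕ.+ 1 ℕ.+ m
    ℕ-arith = ℕ-solve-∀
  cancel : ∀ σ b d P X → σ * ((b + d) * P - (X + b * 1ℤ * P)) ≡ σ * (P * d - X)
  cancel = solve-∀
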